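{- Let $F$ be a field of characteristic different from $2$ and let $q$ be an anisotropic quadratic form over $F$ such that $\underline{s}_q(F)<\infty$. Then $p_q(F)-1\leqslant \underline{s}_q(F)\leqslant p_q(F)$.
   Context: All forms are regular quadratic forms; $n\times q$ is the orthogonal sum of $n$ copies of $q$. The $q$-sublevel is $\underline{s}_q(F)=\inf\{n\in\mathbb{N}\mid (n+1)\times q\text{ isotropic over }F\}$ ($\infty$ if none). For $a\in F^\times$ the $q$-length is $\ell_q(a)=\inf\{n\in\mathbb{N}\mid n\times q\perp\langle -a\rangle\text{ is isotropic over }F\}$, and the Pythagoras $q$-number is $p_q(F)=\sup\{\ell_q(a)\mid a\in F^\times,\ \ell_q(a)<\infty\}$. -}

module Defs where

open import Level using (Level; _⊔_)
open import Data.Nat as ℕ using (ℕ; zero; suc; _≤_; _<_)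
open import Data.Fin using (Fin; splitAt)
open import Data.Sum using (_⊎_; inj₁; inj₂)
open import Data.Product using (Σ; ∃; _×_; _,_)
open import Relation.Binary.PropositionalEquality using (_≡_)
open import Relation.Nullary using (¬_)
open import Algebra.Bundles using (CommutativeRing)

record Field (c ℓ : Level) : Set (Level.suc (c ⊔ ℓ)) where
  field
    commutativeRing : CommutativeRing c ℓ
  open CommutativeRing commutativeRing public
  field
    1≉0     : ¬ (1# ≈ 0#)
    inverse : ∀ x → ¬ (x ≈ 0#) → ∃ λ y → x * y ≈ 1#

module FieldTheory {c ℓ : Level} (F : Field c ℓ) where
  open Field F

  CharNot2 : Set ℓ
  CharNot2 = ¬ (1# + 1# ≈ 0#)

  Σᶠ : ∀ {n} → (Fin n → Carrier) → Carrier
  Σᶠ {zero}  v = 0#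
  Σᶠ {suc n} v = v Fin.zero + Σᶠ (λ i → v (Fin.suc i))
    where import Data.Fin as Fin

  -- A quadratic form in `dim` variables, given by its (symmetric) Gram matrix:
  -- q(x) = Σ_{i,j} B i j · x_i · x_j.
  record QForm : Set c where
    constructor form
    field
      dim : ℕ
      mat : Fin dim → Fin dim → Carrier
  open QForm public

  value : (q : QForm) → (Fin (dim q) → Carrier) → Carrier
  value q x = Σᶠ λ i → Σᶠ λ j → mat q i j * x i * x j

  polar : (q : QForm) → (Fin (dim q) → Carrier) → (Fin (dim q) → Carrier) → Carrier
  polar q x y = Σᶠ λ i → Σᶠ λ j → mat q i j * x i * y j

  Symmetric : QForm → Set ℓ
  Symmetric q = ∀ i j → mat q i j ≈ mat q j i

  Nondegenerate : QForm → Set (c ⊔ ℓ)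
  Nondegenerate q = ∀ x → (∀ y → polar q x y ≈ 0#) → ∀ i → x i ≈ 0#

  Regular : QForm → Set (c ⊔ ℓ)
  Regular q = Symmetric q × Nondegenerate q

  NonZeroVec : ∀ {n} → (Fin n → Carrier) → Set ℓ
  NonZeroVec {n} x = Σ (Fin n) λ i → ¬ (x i ≈ 0#)

  Isotropic : QForm → Set (c ⊔ ℓ)
  Isotropic q = Σ (Fin (dim q) → Carrier) λ x → NonZeroVec x × value q x ≈ 0#

  Anisotropic : QForm → Set (c ⊔ ℓ)
  Anisotropic q = ¬ Isotropic q

  _⊥_ : QForm → QForm → QForm
  form m A ⊥ form k B = form (m ℕ.+ k) M
    where
      M : Fin (m ℕ.+ k) → Fin (m ℕ.+ k) → Carrier
      M i j with splitAt m i | splitAt m j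
      ... | inj₁ i′ | inj₁ j′ = A i′ j′
      ... | inj₂ i′ | inj₂ j′ = B i′ j′
      ... | inj₁ _  | inj₂ _  = 0#
      ... | inj₂ _  | inj₁ _  = 0#

  𝟘 : QForm
  𝟘 = form 0 (λ ())

  _×ᵠ_ : ℕ → QForm → QForm
  zero  ×ᵠ q = 𝟘
  suc n ×ᵠ q = q ⊥ (n ×ᵠ q)

  ⟨_⟩ : Carrier → QForm
  ⟨ a ⟩ = form 1 (λ _ _ → a)

  -- s is the q-sublevel  s_q(F) = inf { n | (n+1) × q isotropic }  (finite case)
  IsSublevel : QForm → ℕ → Set (c ⊔ ℓ)
  IsSublevel q s = Isotropic (suc s ×ᵠ q) × (∀ n → n < s → ¬ Isotropic (suc n ×ᵠ q))

  -- n is the q-length  ℓ_q(a) = inf { n | n × q ⊥ ⟨-a⟩ isotropic }  (finite case)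
  IsLength : QForm → Carrier → ℕ → Set (c ⊔ ℓ)
  IsLength q a n = Isotropic ((n ×ᵠ q) ⊥ ⟨ - a ⟩)
                 × (∀ m → m < n → ¬ Isotropic ((m ×ᵠ q) ⊥ ⟨ - a ⟩))

  -- p_q(F) = sup { ℓ_q(a) | a ∈ F^×, ℓ_q(a) < ∞ }  ∈ ℕ ∪ {∞}.
  -- "p_q(F) ≤ k" for k ∈ ℕ: every finite length is at most k.
  PythagorasAtMost : QForm → ℕ → Set (c ⊔ ℓ)
  PythagorasAtMost q k = ∀ a → ¬ (a ≈ 0#) → ∀ n → IsLength q a n → n ≤ k

  -- "k ≤ p_q(F)" for k ∈ ℕ: k = 0, or some finite length is at least k.
  PythagorasAtLeast : QForm → ℕ → Set (c ⊔ ℓ)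
  PythagorasAtLeast q k =
    k ≡ 0 ⊎ Σ Carrier λ a → ¬ (a ≈ 0#) × Σ ℕ λ n → IsLength q a n × k ≤ n

module Submission where

-- Upper bound.  (s+1)×q is isotropic, hence so is (s+1)×q ⊥ ⟨−a⟩ for every a
-- (extend by zero), so no q-length exceeds s+1.
--
-- Lower bound.  Take an isotropic vector of (s+1)×q.  Moving the q-block that
-- contains a nonzero coordinate to the front gives w ≠ 0 and r with
-- q(w) + (s×q)(r) = 0.  Put a = (s×q)(r); a ≠ 0 because q is anisotropic, and
-- a has q-length exactly s: (r , 1) is isotropic for s×q ⊥ ⟨−a⟩, while an
-- isotropic vector (u , t) of m×q ⊥ ⟨−a⟩ yields the isotropic vector (t·w , u)
-- of q ⊥ m×q = (m+1)×q, impossible for m < s by minimality of s.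
--
-- The module Proof develops finite sums, the value of a form on an orthogonal
-- sum, the block reordering lemma, and the isotropy transfer lemmas; the
-- theorem is assembled from them at the end.

open import Defs
open import Data.Nat using (ℕ; suc)
open import Data.Product using (_×_)

open import Data.Nat as ℕ using (zero; _≤?_)
open import Data.Nat.Properties using (≰⇒>; ≤-refl)
open import Data.Fin using (Fin; splitAt; _↑ˡ_; _↑ʳ_) renaming (zero to fzero; suc to fsuc)
open import Data.Fin.Properties using (splitAt-↑ˡ; splitAt-↑ʳ; splitAt⁻¹-↑ˡ; splitAt⁻¹-↑ʳ)
open import Data.Sum using (_⊎_; inj₁; inj₂; [_,_]′)
open import Data.Product using (Σ; _,_; proj₁; proj₂)
open import Data.Empty using (⊥-elim)
open import Data.Maybe using (nothing)
open import Relation.Nullary using (¬_; yes; no)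
open import Relation.Binary.PropositionalEquality using (_≡_; subst)
import Relation.Binary.Reasoning.Setoid as ≈-Reasoning
import Algebra.Solver.Ring.NaturalCoefficients as NaturalCoefficients
import Algebra.Properties.Group as GroupProperties

module Proof {c ℓ} (F : Field c ℓ) where
  open Field F
  open FieldTheory F
  open NaturalCoefficients commutativeSemiring (λ _ _ → nothing)
  open GroupProperties +-group using (inverseˡ-unique)

  Vector : ℕ → Set c
  Vector n = Fin n → Carrier

  Σᶠ-cong : ∀ {n} {u v : Vector n} → (∀ i → u i ≈ v i) → Σᶠ u ≈ Σᶠ v
  Σᶠ-cong {zero}  u≈v = refl
  Σᶠ-cong {suc n} u≈v = +-cong (u≈v fzero) (Σᶠ-cong (λ i → u≈v (fsuc i)))

  Σᶠ-zero : ∀ {n} (v : Vector n) → (∀ i → v i ≈ 0#) → Σᶠ v ≈ 0#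
  Σᶠ-zero {zero}  v v≈0 = refl
  Σᶠ-zero {suc n} v v≈0 =
    trans (+-cong (v≈0 fzero) (Σᶠ-zero _ (λ i → v≈0 (fsuc i)))) (+-identityˡ 0#)

  Σᶠ-scale : ∀ {n} (k : Carrier) (v : Vector n) → Σᶠ (λ i → k * v i) ≈ k * Σᶠ v
  Σᶠ-scale {zero}  k v = sym (zeroʳ k)
  Σᶠ-scale {suc n} k v =
    trans (+-congˡ (Σᶠ-scale k (λ i → v (fsuc i)))) (sym (distribˡ k _ _))

  Σᶠ-split : ∀ m {k} (v : Vector (m ℕ.+ k)) →
             Σᶠ v ≈ Σᶠ (λ i → v (i ↑ˡ k)) + Σᶠ (λ j → v (m ↑ʳ j))
  Σᶠ-split zero    v = sym (+-identityˡ _)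
  Σᶠ-split (suc m) v =
    trans (+-congˡ (Σᶠ-split m (λ i → v (fsuc i)))) (sym (+-assoc _ _ _))

  value-cong : ∀ q {x y : Vector (dim q)} → (∀ i → x i ≈ y i) → value q x ≈ value q y
  value-cong q x≈y = Σᶠ-cong (λ i → Σᶠ-cong (λ j → *-cong (*-congˡ (x≈y i)) (x≈y j)))

  value-scale : ∀ q t (w : Vector (dim q)) → value q (λ i → t * w i) ≈ (t * t) * value q w
  value-scale q t w =
    trans (Σᶠ-cong (λ i → trans (Σᶠ-cong (λ j → pull (mat q i j) (w i) (w j)))
                                (Σᶠ-scale (t * t) (λ j → mat q i j * w i * w j))))
          (Σᶠ-scale (t * t) (λ i → Σᶠ (λ j → mat q i j * w i * w j)))
    where
      pull : ∀ B x y → B * (t * x) * (t * y) ≈ (t * t) * (B * x * y)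
      pull = solve 4 (λ t B x y → B :* (t :* x) :* (t :* y) := (t :* t) :* (B :* x :* y)) refl t

  value-zero : ∀ q → value q (λ _ → 0#) ≈ 0#
  value-zero q = Σᶠ-zero _ (λ i → Σᶠ-zero _ (λ j → zeroʳ (mat q i j * 0#)))

  value-⟨⟩ : ∀ a (z : Vector 1) → value ⟨ a ⟩ z ≈ a * z fzero * z fzero
  value-⟨⟩ a z = trans (+-identityʳ _) (+-identityʳ _)

  left : ∀ {m k} → Vector (m ℕ.+ k) → Vector m
  left {k = k} x i = x (i ↑ˡ k)

  right : ∀ {m k} → Vector (m ℕ.+ k) → Vector k
  right {m} x j = x (m ↑ʳ j)

  join : ∀ {m k} → Vector m → Vector k → Vector (m ℕ.+ k)
  join {m} u v I = [ u , v ]′ (splitAt m I)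

  left-join : ∀ {m k} (u : Vector m) (v : Vector k) i → left {m} (join u v) i ≡ u i
  left-join {m} {k} u v i rewrite splitAt-↑ˡ m i k = _≡_.refl

  right-join : ∀ {m k} (u : Vector m) (v : Vector k) j → right {m} (join u v) j ≡ v j
  right-join {m} {k} u v j rewrite splitAt-↑ʳ m k j = _≡_.refl

  nonZero-split : ∀ {m k} (x : Vector (m ℕ.+ k)) → NonZeroVec x →
                  NonZeroVec (left {m} x) ⊎ NonZeroVec (right {m} x)
  nonZero-split {m} x (I , xI≉0) with splitAt m I in eq
  ... | inj₁ i = inj₁ (i , λ xi≈0 → xI≉0 (subst (λ z → x z ≈ 0#) (splitAt⁻¹-↑ˡ eq) xi≈0))
  ... | inj₂ j = inj₂ (j , λ xj≈0 → xI≉0 (subst (λ z → x z ≈ 0#) (splitAt⁻¹-↑ʳ eq) xj≈0))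

  nonZero-joinˡ : ∀ {m k} (u : Vector m) (v : Vector k) → NonZeroVec u → NonZeroVec (join u v)
  nonZero-joinˡ {k = k} u v (i , ui≉0) = i ↑ˡ k , λ e → ui≉0 (trans (sym (reflexive (left-join u v i))) e)

  nonZero-joinʳ : ∀ {m k} (u : Vector m) (v : Vector k) → NonZeroVec v → NonZeroVec (join u v)
  nonZero-joinʳ {m} u v (j , vj≉0) = m ↑ʳ j , λ e → vj≉0 (trans (sym (reflexive (right-join u v j))) e)

  module Blocks (A B : QForm) where
    m : ℕ
    m = dim A
    k : ℕ
    k = dim B

    mat-ll : ∀ i j → mat (A ⊥ B) (i ↑ˡ k) (j ↑ˡ k) ≡ mat A i j
    mat-ll i j rewrite splitAt-↑ˡ m i k | splitAt-↑ˡ m j k = _≡_.refl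

    mat-lr : ∀ i j → mat (A ⊥ B) (i ↑ˡ k) (m ↑ʳ j) ≡ 0#
    mat-lr i j rewrite splitAt-↑ˡ m i k | splitAt-↑ʳ m k j = _≡_.refl

    mat-rl : ∀ i j → mat (A ⊥ B) (m ↑ʳ i) (j ↑ˡ k) ≡ 0#
    mat-rl i j rewrite splitAt-↑ʳ m k i | splitAt-↑ˡ m j k = _≡_.refl

    mat-rr : ∀ i j → mat (A ⊥ B) (m ↑ʳ i) (m ↑ʳ j) ≡ mat B i j
    mat-rr i j rewrite splitAt-↑ʳ m k i | splitAt-↑ʳ m k j = _≡_.refl

  value-⊥ : ∀ A B (x : Vector (dim (A ⊥ B))) →
            value (A ⊥ B) x ≈ value A (left {dim A} x) + value B (right {dim A} x)
  value-⊥ A B x =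
    trans (Σᶠ-cong (λ I → Σᶠ-split m (term I)))
      (trans (Σᶠ-split m (λ I → Σᶠ (λ j → term I (j ↑ˡ k)) + Σᶠ (λ j → term I (m ↑ʳ j))))
        (+-cong (Σᶠ-cong leftRow) (Σᶠ-cong rightRow)))
    where
      open Blocks A B
      term : Fin (m ℕ.+ k) → Fin (m ℕ.+ k) → Carrier
      term I J = mat (A ⊥ B) I J * x I * x J

      vanish : ∀ {e y z} → e ≡ 0# → e * y * z ≈ 0#
      vanish {e} {y} {z} e≡0 = trans (*-congʳ (trans (*-congʳ (reflexive e≡0)) (zeroˡ y))) (zeroˡ z)

      leftRow : ∀ i → Σᶠ (λ j → term (i ↑ˡ k) (j ↑ˡ k)) + Σᶠ (λ j → term (i ↑ˡ k) (m ↑ʳ j))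
                      ≈ Σᶠ (λ j → mat A i j * left {m} x i * left {m} x j)
      leftRow i = trans (+-cong (Σᶠ-cong (λ j → *-congʳ (*-congʳ (reflexive (mat-ll i j)))))
                                (Σᶠ-zero _ (λ j → vanish (mat-lr i j))))
                        (+-identityʳ _)

      rightRow : ∀ i → Σᶠ (λ j → term (m ↑ʳ i) (j ↑ˡ k)) + Σᶠ (λ j → term (m ↑ʳ i) (m ↑ʳ j))
                       ≈ Σᶠ (λ j → mat B i j * right {m} x i * right {m} x j)
      rightRow i = trans (+-cong (Σᶠ-zero _ (λ j → vanish (mat-rl i j)))
                                 (Σᶠ-cong (λ j → *-congʳ (*-congʳ (reflexive (mat-rr i j))))))
                         (+-identityˡ _)

  value-join : ∀ A B (u : Vector (dim A)) (v : Vector (dim B)) →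
               value (A ⊥ B) (join u v) ≈ value A u + value B v
  value-join A B u v =
    trans (value-⊥ A B (join u v))
          (+-cong (value-cong A (λ i → reflexive (left-join u v i)))
                  (value-cong B (λ j → reflexive (right-join u v j))))

  *-nonZero : ∀ {t w} → ¬ (t ≈ 0#) → ¬ (w ≈ 0#) → ¬ (t * w ≈ 0#)
  *-nonZero {t} {w} t≉0 w≉0 tw≈0 with inverse t t≉0
  ... | y , ty≈1 = w≉0 (trans (sym (*-identityˡ w)) (trans (*-congʳ (sym ty≈1))
                         (trans (reassoc t y w) (trans (*-congˡ tw≈0) (zeroʳ y)))))
    where
      reassoc : ∀ t y w → (t * y) * w ≈ y * (t * w)
      reassoc = solve 3 (λ t y w → (t :* y) :* w := y :* (t :* w)) refl

  isotropic-⊥ : ∀ A B → Isotropic A → Isotropic (A ⊥ B)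
  isotropic-⊥ A B (x , x≢0 , Ax≈0) =
    join x (λ _ → 0#) , nonZero-joinˡ x _ x≢0 ,
    trans (value-join A B x _)
          (trans (+-cong Ax≈0 (value-zero B)) (+-identityʳ 0#))

  -- Reordering blocks: every nonzero vector x of (n+1)×q can be traded for a pair
  -- (w , r) with w ≠ 0 and ((n+1)×q)(x) = q(w) + (n×q)(r); w is the q-block of x
  -- containing a nonzero coordinate and r collects the remaining blocks.
  frontBlock : ∀ q n (x : Vector (dim (suc n ×ᵠ q))) → NonZeroVec x →
    Σ (Vector (dim q)) λ w → Σ (Vector (dim (n ×ᵠ q))) λ r →
      NonZeroVec w × value (suc n ×ᵠ q) x ≈ value q w + value (n ×ᵠ q) r
  frontBlock q n x x≢0 with nonZero-split {dim q} x x≢0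
  ... | inj₁ first≢0 = left {dim q} x , right {dim q} x , first≢0 , value-⊥ q (n ×ᵠ q) x
  frontBlock q zero    x x≢0 | inj₂ (() , _)
  frontBlock q (suc n) x x≢0 | inj₂ rest≢0
    with frontBlock q n (right {dim q} x) rest≢0
  ... | w , r , w≢0 , rest≈ =
    w , join first r , w≢0 ,
    (begin
      value (suc (suc n) ×ᵠ q) x                          ≈⟨ value-⊥ q (suc n ×ᵠ q) x ⟩
      value q first + value (suc n ×ᵠ q) (right {dim q} x) ≈⟨ +-congˡ rest≈ ⟩
      value q first + (value q w + value (n ×ᵠ q) r)       ≈⟨ exchange _ _ _ ⟩
      value q w + (value q first + value (n ×ᵠ q) r)       ≈⟨ +-congˡ (sym (value-join q (n ×ᵠ q) first r)) ⟩
      value q w + value (suc n ×ᵠ q) (join first r)        ∎)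
    where
      open ≈-Reasoning setoid
      first : Vector (dim q)
      first = left {dim q} x
      exchange : ∀ x y z → x + (y + z) ≈ y + (x + z)
      exchange = solve 3 (λ x y z → x :+ (y :+ z) := y :+ (x :+ z)) refl

  isotropic-⊥-⟨-value⟩ : ∀ B r → Isotropic (B ⊥ ⟨ - value B r ⟩)
  isotropic-⊥-⟨-value⟩ B r =
    join r (λ _ → 1#) , nonZero-joinʳ r _ (fzero , 1≉0) ,
    trans (value-join B ⟨ - a ⟩ r _)
          (trans (+-congˡ (trans (value-⟨⟩ (- a) (λ _ → 1#)) (trans (*-identityʳ _) (*-identityʳ _))))
                 (-‿inverseʳ a))
    where
      a : Carrier
      a = value B r

  -- If A represents −a by a nonzero vector w and (u , t) is isotropic for B ⊥ ⟨−a⟩,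
  -- then (t·w , u) is isotropic for A ⊥ B, since A(t·w) = −a·t².
  isotropic-absorb : ∀ A B a (w : Vector (dim A)) → NonZeroVec w → value A w ≈ - a →
                     Isotropic (B ⊥ ⟨ - a ⟩) → Isotropic (A ⊥ B)
  isotropic-absorb A B a w w≢0 Aw≈-a (y , y≢0 , y-iso) = join tw u , tw,u≢0 , tw,u-iso
    where
      u : Vector (dim B)
      u = left {dim B} y
      t : Carrier
      t = y (dim B ↑ʳ fzero)
      tw : Vector (dim A)
      tw i = t * w i

      tw,u≢0 : NonZeroVec (join tw u)
      tw,u≢0 with nonZero-split {dim B} y y≢0
      ... | inj₁ u≢0            = nonZero-joinʳ tw u u≢0
      ... | inj₂ (fzero , t≉0) = nonZero-joinˡ tw u (proj₁ w≢0 , *-nonZero t≉0 (proj₂ w≢0))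

      rearrange : ∀ t n v → (t * t) * n + v ≈ v + n * t * t
      rearrange = solve 3 (λ t n v → (t :* t) :* n :+ v := v :+ n :* t :* t) refl

      open ≈-Reasoning setoid
      tw,u-iso : value (A ⊥ B) (join tw u) ≈ 0#
      tw,u-iso = begin
        value (A ⊥ B) (join tw u)                            ≈⟨ value-join A B tw u ⟩
        value A tw + value B u                               ≈⟨ +-congʳ (value-scale A t w) ⟩
        (t * t) * value A w + value B u                      ≈⟨ +-congʳ (*-congˡ Aw≈-a) ⟩
        (t * t) * (- a) + value B u                          ≈⟨ rearrange t (- a) _ ⟩
        value B u + (- a) * t * t                            ≈⟨ +-congˡ (sym (value-⟨⟩ (- a) (right {dim B} y))) ⟩
        value B u + value ⟨ - a ⟩ (right {dim B} y)          ≈⟨ sym (value-⊥ B ⟨ - a ⟩ y) ⟩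
        value (B ⊥ ⟨ - a ⟩) y                                ≈⟨ y-iso ⟩
        0#                                                   ∎

  length-bound : ∀ q k → Isotropic (k ×ᵠ q) → PythagorasAtMost q k
  length-bound q k k×q-iso a _ n (_ , below-n-aniso) with n ≤? k
  ... | yes n≤k = n≤k
  ... | no  n≰k = ⊥-elim (below-n-aniso k (≰⇒> n≰k) (isotropic-⊥ (k ×ᵠ q) ⟨ - a ⟩ k×q-iso))

  length-of-complement : ∀ q s → IsSublevel q s → ∀ w r → NonZeroVec w →
                         value q w + value (s ×ᵠ q) r ≈ 0# → IsLength q (value (s ×ᵠ q) r) s
  length-of-complement q s (_ , below-s-aniso) w r w≢0 sum≈0 =
    isotropic-⊥-⟨-value⟩ (s ×ᵠ q) r ,
    λ m m<s m-iso → below-s-aniso m m<s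
      (isotropic-absorb q (m ×ᵠ q) (value (s ×ᵠ q) r) w w≢0 qw≈-a m-iso)
    where
      qw≈-a : value q w ≈ - value (s ×ᵠ q) r
      qw≈-a = inverseˡ-unique _ _ sum≈0

mainTheorem11 : ∀ {c ℓ} (F : Field c ℓ) → let open FieldTheory F in
    CharNot2 → (q : QForm) → Regular q → Anisotropic q →
    (s : ℕ) → IsSublevel q s →
    PythagorasAtMost q (suc s) × PythagorasAtLeast q s
mainTheorem11 F _ q _ q-aniso s sublevel@((x , x≢0 , x-iso) , _)
  with Proof.frontBlock F q s x x≢0
... | w , r , w≢0 , x≈w+r = length-bound q (suc s) (x , x≢0 , x-iso) , lower-bound
  where
    open Field F
    open FieldTheory F
    open Proof F

    a : Carrier
    a = value (s ×ᵠ q) r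

    w+r≈0 : value q w + a ≈ 0#
    w+r≈0 = trans (sym x≈w+r) x-iso

    a≉0 : ¬ (a ≈ 0#)
    a≉0 a≈0 = q-aniso (w , w≢0 , trans (sym (+-identityʳ _)) (trans (+-congˡ (sym a≈0)) w+r≈0))

    lower-bound : PythagorasAtLeast q s
    lower-bound = inj₂ (a , a≉0 , s , length-of-complement q s sublevel w r w≢0 w+r≈0 , ≤-refl)
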